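{- Let $p$ be a prime, let $H$ be a graph with vertex set $[m]$, and let $\lambda_1,\dots,\lambda_m$ be distinct elements of $\mathbb{F}_p$; write $\lambda_{ij} = \lambda_j - \lambda_i$. For each edge $\{i,j\}$ of $H$, let $G(ij)$ be the bipartite graph with parts $X_i = \mathbb{F}_p^2 \times \{i\}$ and $X_j = \mathbb{F}_p^2 \times\{j\}$ in which $(x,i)$ is adjacent to $(y,j)$ if and only if $y = x + \lambda_{ij}(a,a^2)$ for some $a \in \mathbb{F}_p^*$. Then for every edge $\{i,j\}$ of $H$, the graph $G(ij)$ contains no cycle of length four.
   Context: Scalar multiplication $\lambda(a,a^2)$ is componentwise in $\mathbb{F}_p^2$. Note the adjacency relation is symmetric in the roles of $i$ and $j$ since $\lambda_{ji} = -\lambda_{ij}$. -}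

module Defs where

open import Data.Nat using (ℕ; zero; suc; _∸_; NonZero) renaming (_+_ to _+ℕ_; _*_ to _*ℕ_)
open import Data.Nat.DivMod using (_mod_)
open import Data.Nat.Primality using (Prime; prime⇒nonZero)
open import Data.Fin using (Fin; toℕ)
open import Data.Product using (_×_; _,_; proj₁; proj₂; Σ; Σ-syntax)
open import Data.Sum using (_⊎_)
open import Data.Empty using (⊥)
open import Relation.Binary.PropositionalEquality using (_≡_; _≢_)

module PrimeField (p : ℕ) (pr : Prime p) where
  private instance
    nz : NonZero p
    nz = prime⇒nonZero pr

  F : Set
  F = Fin p

  _+F_ : F → F → F
  a +F b = (toℕ a +ℕ toℕ b) mod p

  _*F_ : F → F → F
  a *F b = (toℕ a *ℕ toℕ b) mod p

  -F_ : F → F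
  -F a = (p ∸ toℕ a) mod p

  _-F_ : F → F → F
  a -F b = a +F (-F b)

  NonZeroF : F → Set
  NonZeroF a = toℕ a ≢ 0

  F² : Set
  F² = F × F

  _+²_ : F² → F² → F²
  (x₁ , x₂) +² (y₁ , y₂) = (x₁ +F y₁ , x₂ +F y₂)

  _·²_ : F → F² → F²
  c ·² (y₁ , y₂) = (c *F y₁ , c *F y₂)

  curve : F → F²
  curve a = (a , a *F a)

record SimpleGraph (m : ℕ) : Set₁ where
  field
    Adj   : Fin m → Fin m → Set
    sym   : ∀ {i j} → Adj i j → Adj j i
    irrefl : ∀ {i} → Adj i i → ⊥

module Construction (p : ℕ) (pr : Prime p) (m : ℕ) (λ' : Fin m → Fin p) where
  open PrimeField p pr

  lam : Fin m → Fin m → F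
  lam i j = λ' j -F λ' i

  -- Vertices of type (x , k) with x ∈ F_p^2, k ∈ [m];
  -- G(ij) has vertex set X_i ∪ X_j, X_k = F_p^2 × {k}.
  Vertex : Set
  Vertex = F² × Fin m

  InG : Fin m → Fin m → Vertex → Set
  InG i j v = (proj₂ v ≡ i) ⊎ (proj₂ v ≡ j)

  Dir : Fin m → Fin m → Vertex → Vertex → Set
  Dir i j u v = (proj₂ u ≡ i) × (proj₂ v ≡ j) ×
                (Σ[ a ∈ F ] (NonZeroF a × (proj₁ v ≡ proj₁ u +² (lam i j ·² curve a))))

  AdjG : Fin m → Fin m → Vertex → Vertex → Set
  AdjG i j u v = Dir i j u v ⊎ Dir i j v u

  HasC4 : Fin m → Fin m → Set
  HasC4 i j = Σ[ v₀ ∈ Vertex ] Σ[ v₁ ∈ Vertex ] Σ[ v₂ ∈ Vertex ] Σ[ v₃ ∈ Vertex ]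
    ( (InG i j v₀ × InG i j v₁ × InG i j v₂ × InG i j v₃)
    × (v₀ ≢ v₁ × v₀ ≢ v₂ × v₀ ≢ v₃ × v₁ ≢ v₂ × v₁ ≢ v₃ × v₂ ≢ v₃)
    × (AdjG i j v₀ v₁ × AdjG i j v₁ v₂ × AdjG i j v₂ v₃ × AdjG i j v₃ v₀))

-- Read F_p inside ℤ modulo p and write γ(a) = (a , a²). Let u, w ∈ X_i and v, z ∈ X_j
-- span a 4-cycle with edge labels a (uv), b (wv), c (uz), d (wz). Then u − w equals both
-- λ_ij (γ(b) − γ(a)) and λ_ij (γ(d) − γ(c)); cancelling λ_ij ≠ 0 gives b − a = d − c and
-- b² − a² = d² − c², whence 2 (a − c) (a − b) = 0. So a = b and u = w, or a = c and v = z,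
-- or p = 2, where the only nonzero label is 1 and again a = b. Every 4-cycle of G(ij) has
-- this shape because no two consecutive edges can both point from X_i to X_j.
module Submission where

open import Defs
open import Data.Nat using (ℕ)
open import Data.Nat.Primality using (Prime)
open import Data.Fin using (Fin)
open import Function.Definitions using (Injective)
open import Relation.Binary.PropositionalEquality using (_≡_)
open import Relation.Nullary using (¬_)

import Data.Nat as ℕ
import Data.Nat.Properties as ℕ
import Data.Nat.Divisibility as ℕ
open import Data.Nat.DivMod using (_mod_)
open import Data.Nat.Primality using (prime⇒nonZero; euclidsLemma)
open import Data.Fin using (toℕ)
open import Data.Fin.Properties using (toℕ-fromℕ<; toℕ-injective; toℕ<n)
open import Data.Integer using (ℤ; +_; _+_; _*_; -_; _-_; _⊖_; ∣_∣)
open import Data.Integer.Properties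
  using (pos-+; pos-*; abs-*; m-n≡m⊖n; ⊖-≥; ∣⊖∣-≤; +-comm; *-identityˡ; +-identityʳ)
open import Data.Integer.DivMod using (a≡a%ℕn+[a/ℕn]*n)
open import Data.Integer.Divisibility.Signed
  using (_∣_; divides; ∣m∣n⇒∣m+n; ∣m∣n⇒∣m-n; ∣m⇒∣-m; ∣n⇒∣m*n; ∣⇒∣ᵤ; ∣ᵤ⇒∣; module ∣-Reasoning)
open import Data.Integer.Tactic.RingSolver using (solve)
open import Data.List using (_∷_; [])
open import Data.Product using (_×_; _,_; proj₁; proj₂)
open import Data.Sum using (_⊎_; inj₁; inj₂; swap)
import Data.Sum as Sum
open import Data.Empty using (⊥-elim)
open import Function using (_∘_)
open import Relation.Nullary using (contradiction)
open import Level using (0ℓ)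
open import Relation.Binary.Bundles using (Setoid)
import Relation.Binary.Reasoning.Setoid as SetoidReasoning
open import Relation.Binary.PropositionalEquality using (_≢_; refl; sym; trans; cong; cong₂; subst)

∣∧<⇒≡0 : ∀ {m k} → m ℕ.∣ k → k ℕ.< m → k ≡ 0
∣∧<⇒≡0 {k = ℕ.zero}  _   _   = refl
∣∧<⇒≡0 {k = ℕ.suc _} m∣k k<m = contradiction m∣k (ℕ.>⇒∤ k<m)

n<2∧n≢0⇒n≡1 : ∀ {n} → n ℕ.< 2 → n ≢ 0 → n ≡ 1
n<2∧n≢0⇒n≡1 {ℕ.zero}              _                       n≢0 = contradiction refl n≢0
n<2∧n≢0⇒n≡1 {ℕ.suc ℕ.zero}        _                       _   = refl
n<2∧n≢0⇒n≡1 {ℕ.suc (ℕ.suc _)} (ℕ.s≤s (ℕ.s≤s ())) _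

module Congruence (n : ℤ) where

  infix 4 _≈_ _≈²_

  -- Records (here and for Translate) rather than plain definitions, so that the
  -- integers involved can be inferred from a hypothesis.
  record _≈_ (x y : ℤ) : Set where
    constructor ≈-by
    field divides-difference : n ∣ x - y
  open _≈_ public

  ≈-reflexive : ∀ {x y} → x ≡ y → x ≈ y
  ≈-reflexive {x} refl = ≈-by (divides (+ 0) (solve (x ∷ n ∷ [])))

  ≈-refl : ∀ {x} → x ≈ x
  ≈-refl = ≈-reflexive refl

  ≈-sym : ∀ {x y} → x ≈ y → y ≈ x
  ≈-sym {x} {y} (≈-by n∣x-y) = ≈-by (begin
    n        ∣⟨ ∣m⇒∣-m n∣x-y ⟩
    - (x - y) ≡⟨ solve (x ∷ y ∷ []) ⟩
    y - x    ∎)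
    where open ∣-Reasoning

  ≈-trans : ∀ {x y z} → x ≈ y → y ≈ z → x ≈ z
  ≈-trans {x} {y} {z} (≈-by n∣x-y) (≈-by n∣y-z) = ≈-by (begin
    n                 ∣⟨ ∣m∣n⇒∣m+n n∣x-y n∣y-z ⟩
    (x - y) + (y - z) ≡⟨ solve (x ∷ y ∷ z ∷ []) ⟩
    x - z             ∎)
    where open ∣-Reasoning

  ≈-setoid : Setoid 0ℓ 0ℓ
  ≈-setoid = record
    { Carrier       = ℤ
    ; _≈_           = _≈_
    ; isEquivalence = record { refl = ≈-refl ; sym = ≈-sym ; trans = ≈-trans }
    }

  +-cong : ∀ {x y u v} → x ≈ y → u ≈ v → x + u ≈ y + v
  +-cong {x} {y} {u} {v} (≈-by n∣x-y) (≈-by n∣u-v) = ≈-by (begin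
    n                 ∣⟨ ∣m∣n⇒∣m+n n∣x-y n∣u-v ⟩
    (x - y) + (u - v) ≡⟨ solve (x ∷ y ∷ u ∷ v ∷ []) ⟩
    (x + u) - (y + v) ∎)
    where open ∣-Reasoning

  *-cong : ∀ {x y u v} → x ≈ y → u ≈ v → x * u ≈ y * v
  *-cong {x} {y} {u} {v} (≈-by n∣x-y) (≈-by n∣u-v) = ≈-by (begin
    n                         ∣⟨ ∣m∣n⇒∣m+n (∣n⇒∣m*n x n∣u-v) (∣n⇒∣m*n v n∣x-y) ⟩
    x * (u - v) + v * (x - y) ≡⟨ solve (x ∷ y ∷ u ∷ v ∷ []) ⟩
    x * u - y * v             ∎)
    where open ∣-Reasoning

  +-multiple : ∀ x k → x + k * n ≈ x
  +-multiple x k = ≈-by (divides k (solve (x ∷ k ∷ n ∷ [])))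

  ∣⇒≈0 : ∀ {x} → n ∣ x → x ≈ + 0
  ∣⇒≈0 {x} n∣x = ≈-by (subst (n ∣_) (sym (+-identityʳ x)) n∣x)

  ≈0⇒∣ : ∀ {x} → x ≈ + 0 → n ∣ x
  ≈0⇒∣ {x} (≈-by n∣x-0) = subst (n ∣_) (+-identityʳ x) n∣x-0

  record Translate (k s u v : ℤ) : Set where
    constructor translate
    field translate-≈ : v ≈ u + k * s

  translates-difference : ∀ {k s t u v w} → Translate k s u v → Translate k t w v → u - w ≈ k * (t - s)
  translates-difference {k} {s} {t} {u} {v} {w} (translate (≈-by hu)) (translate (≈-by hw)) =
    ≈-by (begin
    n                                     ∣⟨ ∣m∣n⇒∣m-n hw hu ⟩
    (v - (w + k * t)) - (v - (u + k * s)) ≡⟨ solve (k ∷ s ∷ t ∷ u ∷ v ∷ w ∷ []) ⟩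
    (u - w) - k * (t - s)                 ∎)
    where open ∣-Reasoning

  translates-source-≈ : ∀ {k s t u v w} → Translate k s u v → Translate k t w v → s ≈ t → u ≈ w
  translates-source-≈ {k} {s} {t} {u} {v} {w} hu hw s≈t = ≈-by (begin
    n                                     ∣⟨ ∣m∣n⇒∣m+n (divides-difference (translates-difference hu hw))
                                                         (∣n⇒∣m*n k (divides-difference (≈-sym s≈t))) ⟩
    ((u - w) - k * (t - s)) + k * (t - s) ≡⟨ solve (k ∷ s ∷ t ∷ u ∷ w ∷ []) ⟩
    u - w                                 ∎)
    where open ∣-Reasoning

  translates-target-≈ : ∀ {k s t u v w} → Translate k s u v → Translate k t u w → s ≈ t → v ≈ w
  translates-target-≈ {k} {s} {t} {u} {v} {w} (translate (≈-by hv)) (translate (≈-by hw)) (≈-by s-t) =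
    ≈-by (begin
    n                                                     ∣⟨ ∣m∣n⇒∣m+n (∣m∣n⇒∣m-n hv hw) (∣n⇒∣m*n k s-t) ⟩
    ((v - (u + k * s)) - (w - (u + k * t))) + k * (s - t) ≡⟨ solve (k ∷ s ∷ t ∷ u ∷ v ∷ w ∷ []) ⟩
    v - w                                                 ∎)
    where open ∣-Reasoning

  _≈²_ : ℤ × ℤ → ℤ × ℤ → Set
  x ≈² y = proj₁ x ≈ proj₁ y × proj₂ x ≈ proj₂ y

  record Step (k : ℤ) (x y : ℤ × ℤ) (a : ℤ) : Set where
    field
      step₁ : Translate k a (proj₁ x) (proj₁ y)
      step₂ : Translate k (a * a) (proj₂ x) (proj₂ y)
  open Step public

  Step-source-≈ : ∀ {k x x′ y a b} → Step k x y a → Step k x′ y b → a ≈ b → x ≈² x′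
  Step-source-≈ s t a≈b =
    translates-source-≈ (step₁ s) (step₁ t) a≈b , translates-source-≈ (step₂ s) (step₂ t) (*-cong a≈b a≈b)

  Step-target-≈ : ∀ {k x y y′ a b} → Step k x y a → Step k x y′ b → a ≈ b → y ≈² y′
  Step-target-≈ s t a≈b =
    translates-target-≈ (step₁ s) (step₁ t) a≈b , translates-target-≈ (step₂ s) (step₂ t) (*-cong a≈b a≈b)

  equal-chords⇒∣ : ∀ {a b c d} → b - a ≈ d - c → b * b - a * a ≈ d * d - c * c →
                   n ∣ + 2 * (a - c) * (a - b)
  equal-chords⇒∣ {a} {b} {c} {d} (≈-by n∣X) (≈-by n∣Y) = begin
    n
      ∣⟨ ∣m∣n⇒∣m-n (∣n⇒∣m*n (c + d - a + b) n∣X) n∣Y ⟩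
    (c + d - a + b) * (b - a - (d - c)) - (b * b - a * a - (d * d - c * c))
      ≡⟨ solve (a ∷ b ∷ c ∷ d ∷ []) ⟩
    + 2 * (a - c) * (a - b)
      ∎
    where open ∣-Reasoning

module ModPrime (p : ℕ) (pr : Prime p) where

  open Congruence (+ p) public
  open PrimeField p pr

  private instance
    p≢0 : ℕ.NonZero p
    p≢0 = prime⇒nonZero pr

  euclidsLemmaℤ : ∀ {x y} → + p ∣ x * y → (+ p ∣ x) ⊎ (+ p ∣ y)
  euclidsLemmaℤ {x} {y} p∣xy =
    Sum.map ∣ᵤ⇒∣ ∣ᵤ⇒∣ (euclidsLemma ∣ x ∣ ∣ y ∣ pr (subst (p ℕ.∣_) (abs-* x y) (∣⇒∣ᵤ p∣xy)))

  *-cancelˡ-≈ : ∀ {k x y} → ¬ (+ p ∣ k) → k * x ≈ k * y → x ≈ y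
  *-cancelˡ-≈ {k} {x} {y} p∤k (≈-by p∣kx-ky) with euclidsLemmaℤ p∣k[x-y]
    where
    p∣k[x-y] : + p ∣ k * (x - y)
    p∣k[x-y] = begin
      + p           ∣⟨ p∣kx-ky ⟩
      k * x - k * y ≡⟨ solve (k ∷ x ∷ y ∷ []) ⟩
      k * (x - y)   ∎
      where open ∣-Reasoning
  ... | inj₁ p∣k   = contradiction p∣k p∤k
  ... | inj₂ p∣x-y = ≈-by p∣x-y

  equal-chords : ∀ {a b c d} → b - a ≈ d - c → b * b - a * a ≈ d * d - c * c →
                 (+ p ∣ + 2) ⊎ a ≈ b ⊎ a ≈ c
  equal-chords {a} {b} {c} {d} chord₁ chord₂ with euclidsLemmaℤ (equal-chords⇒∣ {a} {b} {c} {d} chord₁ chord₂)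
  ... | inj₂ p∣a-b = inj₂ (inj₁ (≈-by p∣a-b))
  ... | inj₁ p∣2[a-c] with euclidsLemmaℤ p∣2[a-c]
  ...   | inj₁ p∣2   = inj₁ p∣2
  ...   | inj₂ p∣a-c = inj₂ (inj₂ (≈-by p∣a-c))

  Step-rhombus : ∀ {k x x′ y y′ a b c d} → ¬ (+ p ∣ k) →
                 Step k x y a → Step k x′ y b → Step k x y′ c → Step k x′ y′ d →
                 (+ p ∣ + 2) ⊎ a ≈ b ⊎ a ≈ c
  Step-rhombus {a = a} {b} {c} {d} p∤k xy x′y xy′ x′y′ = equal-chords {a} {b} {c} {d} chord₁ chord₂
    where
    chord₁ : b - a ≈ d - c
    chord₁ = *-cancelˡ-≈ p∤k (≈-trans (≈-sym (translates-difference (step₁ xy) (step₁ x′y)))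
                                      (translates-difference (step₁ xy′) (step₁ x′y′)))
    chord₂ : b * b - a * a ≈ d * d - c * c
    chord₂ = *-cancelˡ-≈ p∤k (≈-trans (≈-sym (translates-difference (step₂ xy) (step₂ x′y)))
                                      (translates-difference (step₂ xy′) (step₂ x′y′)))

  private
    ≤-residues-≈⇒≡ : ∀ {a b} → a ℕ.≤ b → b ℕ.< p → + a ≈ + b → a ≡ b
    ≤-residues-≈⇒≡ {a} {b} a≤b b<p (≈-by p∣a-b) = ℕ.≤-antisym a≤b (ℕ.m∸n≡0⇒m≤n b∸a≡0)
      where
      p∣b∸a : p ℕ.∣ b ℕ.∸ a
      p∣b∸a = subst (p ℕ.∣_) (trans (cong ∣_∣ (m-n≡m⊖n a b)) (∣⊖∣-≤ a≤b)) (∣⇒∣ᵤ p∣a-b)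
      b∸a≡0 : b ℕ.∸ a ≡ 0
      b∸a≡0 = ∣∧<⇒≡0 p∣b∸a (ℕ.≤-<-trans (ℕ.m∸n≤m b a) b<p)

  residues-≈⇒≡ : ∀ {a b} → a ℕ.< p → b ℕ.< p → + a ≈ + b → a ≡ b
  residues-≈⇒≡ {a} {b} a<p b<p a≈b with ℕ.≤-total a b
  ... | inj₁ a≤b = ≤-residues-≈⇒≡ a≤b b<p a≈b
  ... | inj₂ b≤a = sym (≤-residues-≈⇒≡ b≤a a<p (≈-sym a≈b))

  ι : F → ℤ
  ι a = + toℕ a

  ι-injective : ∀ {a b} → ι a ≈ ι b → a ≡ b
  ι-injective {a} {b} = toℕ-injective ∘ residues-≈⇒≡ (toℕ<n a) (toℕ<n b)

  ι-mod : ∀ k → ι (k mod p) ≈ + k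
  ι-mod k = begin
    ι (k mod p)                         ≡⟨ cong +_ (toℕ-fromℕ< _) ⟩
    + (k ℕ.% p)                         ≈⟨ +-multiple (+ (k ℕ.% p)) (+ (k ℕ./ p)) ⟨
    + (k ℕ.% p) + + (k ℕ./ p) * + p     ≡⟨ a≡a%ℕn+[a/ℕn]*n (+ k) p ⟨
    + k                                 ∎
    where open SetoidReasoning ≈-setoid

  ι-+ : ∀ a b → ι (a +F b) ≈ ι a + ι b
  ι-+ a b = ≈-trans (ι-mod _) (≈-reflexive (pos-+ (toℕ a) (toℕ b)))

  ι-* : ∀ a b → ι (a *F b) ≈ ι a * ι b
  ι-* a b = ≈-trans (ι-mod _) (≈-reflexive (pos-* (toℕ a) (toℕ b)))

  ι-neg : ∀ a → ι (-F a) ≈ - ι a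
  ι-neg a = begin
    ι (-F a)            ≈⟨ ι-mod (p ℕ.∸ t) ⟩
    + (p ℕ.∸ t)         ≡⟨ ⊖-≥ (ℕ.<⇒≤ (toℕ<n a)) ⟨
    p ⊖ t               ≡⟨ m-n≡m⊖n p t ⟨
    + p - + t           ≡⟨ +-comm (+ p) (- + t) ⟩
    - + t + + p         ≡⟨ cong (_+_ (- + t)) (*-identityˡ (+ p)) ⟨
    - + t + + 1 * + p   ≈⟨ +-multiple (- + t) (+ 1) ⟩
    - + t               ∎
    where
    t = toℕ a
    open SetoidReasoning ≈-setoid

  p∣ι[b-a]⇒a≡b : ∀ {a b} → + p ∣ ι (b -F a) → a ≡ b
  p∣ι[b-a]⇒a≡b {a} {b} p∣ι[b-a] = sym (ι-injective (≈-by (≈0⇒∣ ι[b-a]≈0)))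
    where
    ι[b-a]≈0 : ι b - ι a ≈ + 0
    ι[b-a]≈0 = ≈-trans (≈-sym (≈-trans (ι-+ b (-F a)) (+-cong (≈-refl {ι b}) (ι-neg a)))) (∣⇒≈0 p∣ι[b-a])

  p∣2⇒NonZeroF-unique : + p ∣ + 2 → ∀ {a b} → NonZeroF a → NonZeroF b → a ≡ b
  p∣2⇒NonZeroF-unique p∣2 {a} {b} a≢0 b≢0 = toℕ-injective (trans (toℕ≡1 a≢0) (sym (toℕ≡1 b≢0)))
    where
    toℕ≡1 : ∀ {x} → NonZeroF x → toℕ x ≡ 1
    toℕ≡1 {x} x≢0 = n<2∧n≢0⇒n≡1 (ℕ.<-≤-trans (toℕ<n x) (ℕ.∣⇒≤ (∣⇒∣ᵤ p∣2))) x≢0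

  ι² : F² → ℤ × ℤ
  ι² (x₁ , x₂) = ι x₁ , ι x₂

  ι²-injective : ∀ {x y} → ι² x ≈² ι² y → x ≡ y
  ι²-injective (x₁≈y₁ , x₂≈y₂) = cong₂ _,_ (ι-injective x₁≈y₁) (ι-injective x₂≈y₂)

  curve-Step : ∀ x k a {y} → y ≡ x +² (k ·² curve a) → Step (ι k) (ι² x) (ι² y) (ι a)
  curve-Step (x₁ , x₂) k a refl = record
    { step₁ = translate (≈-trans (ι-+ x₁ (k *F a)) (+-cong (≈-refl {ι x₁}) (ι-* k a)))
    ; step₂ = translate (≈-trans (ι-+ x₂ (k *F (a *F a)))
                          (+-cong (≈-refl {ι x₂}) (≈-trans (ι-* k (a *F a)) (*-cong (≈-refl {ι k}) (ι-* a a)))))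
    }

module _ (p : ℕ) (pr : Prime p) (m : ℕ) (λ' : Fin m → Fin p) where

  open PrimeField p pr
  open Construction p pr m λ'
  open ModPrime p pr

  vertex-≡ : ∀ {u w : Vertex} → ι² (proj₁ u) ≈² ι² (proj₁ w) → proj₂ u ≡ proj₂ w → u ≡ w
  vertex-≡ coords≈ same-part = cong₂ _,_ (ι²-injective coords≈) same-part

  Dir-not-composable : ∀ {i j x y z} → i ≢ j → Dir i j x y → ¬ Dir i j y z
  Dir-not-composable i≢j (_ , y∈j , _) (y∈i , _ , _) = i≢j (trans (sym y∈i) y∈j)

  rhombus-degenerate : ∀ {i j u v w z} → λ' i ≢ λ' j →
                       Dir i j u v → Dir i j w v → Dir i j u z → Dir i j w z → u ≡ w ⊎ v ≡ z
  rhombus-degenerate {i} {j} {u} {v} {w} {z} λi≢λj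
    (u∈i , v∈j , a , a≢0 , uv) (w∈i , _ , b , b≢0 , wv) (_ , z∈j , c , _ , uz) (_ , _ , d , _ , wz) =
    conclude (Step-rhombus p∤L step-uv step-wv step-uz step-wz)
    where
    L : F
    L = lam i j
    p∤L : ¬ (+ p ∣ ι L)
    p∤L = λi≢λj ∘ p∣ι[b-a]⇒a≡b
    step-uv : Step (ι L) (ι² (proj₁ u)) (ι² (proj₁ v)) (ι a)
    step-uv = curve-Step (proj₁ u) L a uv
    step-wv : Step (ι L) (ι² (proj₁ w)) (ι² (proj₁ v)) (ι b)
    step-wv = curve-Step (proj₁ w) L b wv
    step-uz : Step (ι L) (ι² (proj₁ u)) (ι² (proj₁ z)) (ι c)
    step-uz = curve-Step (proj₁ u) L c uz
    step-wz : Step (ι L) (ι² (proj₁ w)) (ι² (proj₁ z)) (ι d)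
    step-wz = curve-Step (proj₁ w) L d wz
    u≡w : ι a ≈ ι b → u ≡ w
    u≡w a≈b = vertex-≡ (Step-source-≈ step-uv step-wv a≈b) (trans u∈i (sym w∈i))
    conclude : (+ p ∣ + 2) ⊎ ι a ≈ ι b ⊎ ι a ≈ ι c → u ≡ w ⊎ v ≡ z
    conclude (inj₁ p∣2)         = inj₁ (u≡w (≈-reflexive (cong ι (p∣2⇒NonZeroF-unique p∣2 a≢0 b≢0))))
    conclude (inj₂ (inj₁ a≈b)) = inj₁ (u≡w a≈b)
    conclude (inj₂ (inj₂ a≈c)) = inj₂ (vertex-≡ (Step-target-≈ step-uv step-uz a≈c) (trans v∈j (sym z∈j)))

  closed-4-walk-degenerate : ∀ {i j v₀ v₁ v₂ v₃} → i ≢ j → λ' i ≢ λ' j →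
    AdjG i j v₀ v₁ → AdjG i j v₁ v₂ → AdjG i j v₂ v₃ → AdjG i j v₃ v₀ → v₀ ≡ v₂ ⊎ v₁ ≡ v₃
  closed-4-walk-degenerate {i} {j} i≢j λi≢λj = walk
    where
    walk : ∀ {v₀ v₁ v₂ v₃} → AdjG i j v₀ v₁ → AdjG i j v₁ v₂ → AdjG i j v₂ v₃ → AdjG i j v₃ v₀ →
           v₀ ≡ v₂ ⊎ v₁ ≡ v₃
    walk (inj₁ d₀₁) (inj₂ d₂₁) (inj₁ d₂₃) (inj₂ d₀₃) = rhombus-degenerate λi≢λj d₀₁ d₂₁ d₀₃ d₂₃
    walk (inj₂ d₁₀) (inj₁ d₁₂) (inj₂ d₃₂) (inj₁ d₃₀) = swap (rhombus-degenerate λi≢λj d₁₀ d₃₀ d₁₂ d₃₂)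
    walk (inj₁ d₀₁) (inj₁ d₁₂) _          _          = ⊥-elim (Dir-not-composable i≢j d₀₁ d₁₂)
    walk (inj₂ d₁₀) (inj₂ d₂₁) _          _          = ⊥-elim (Dir-not-composable i≢j d₂₁ d₁₀)
    walk (inj₁ _)   (inj₂ d₂₁) (inj₂ d₃₂) _          = ⊥-elim (Dir-not-composable i≢j d₃₂ d₂₁)
    walk (inj₂ _)   (inj₁ d₁₂) (inj₁ d₂₃) _          = ⊥-elim (Dir-not-composable i≢j d₁₂ d₂₃)
    walk (inj₁ _)   (inj₂ _)   (inj₁ d₂₃) (inj₁ d₃₀) = ⊥-elim (Dir-not-composable i≢j d₂₃ d₃₀)
    walk (inj₂ _)   (inj₁ _)   (inj₂ d₃₂) (inj₂ d₀₃) = ⊥-elim (Dir-not-composable i≢j d₀₃ d₃₂)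

lemma2 : (p : ℕ) (pr : Prime p) (m : ℕ) (H : SimpleGraph m)
         (λ' : Fin m → Fin p) → Injective _≡_ _≡_ λ' →
         ∀ i j → SimpleGraph.Adj H i j →
         ¬ Construction.HasC4 p pr m λ' i j
lemma2 p pr m H λ' λ'-injective i j i~j
  (v₀ , v₁ , v₂ , v₃ , _ , (_ , v₀≢v₂ , _ , _ , v₁≢v₃ , _) , (e₀₁ , e₁₂ , e₂₃ , e₃₀))
  with closed-4-walk-degenerate p pr m λ' i≢j (i≢j ∘ λ'-injective) e₀₁ e₁₂ e₂₃ e₃₀
  where
  i≢j : i ≢ j
  i≢j refl = SimpleGraph.irrefl H i~j
... | inj₁ v₀≡v₂ = v₀≢v₂ v₀≡v₂
... | inj₂ v₁≡v₃ = v₁≢v₃ v₁≡v₃
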